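{- Let $G$ be a graph in $\varepsilon_0$ with $p$ vertices and $q$ edges. Then $G$ is bipartite and $q\equiv 0 \pmod 4$.
   Context: All graphs are finite, simple, undirected and connected. An Euler graph is a connected graph in which every vertex has even degree. $\varepsilon_0$ denotes the class of Euler graphs $G$ such that every cycle of $G$ has length $n\equiv 0 \pmod 4$. -}

module Defs where

open import Data.Nat using (ℕ; zero; suc; _<_; _≤_)
open import Data.Nat.Divisibility using (_∣_)
open import Data.Bool using (Bool; true; false; if_then_else_)
open import Data.Fin using (Fin; toℕ; inject₁; fromℕ) renaming (zero to fzero; suc to fsuc)
open import Data.List using (List; allFin; map; concatMap)
open import Data.Nat.ListAction using (sum)
open import Data.Product using (Σ; _×_; ∃)
open import Relation.Binary.PropositionalEquality using (_≡_; _≢_)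
open import Relation.Nullary using (¬_)
open import Relation.Nullary.Decidable using (⌊_⌋)
open import Data.Nat using (_<?_)
open import Data.Bool using (_∧_)
open import Function.Definitions using (Injective)

record Graph (p : ℕ) : Set where
  field
    adj    : Fin p → Fin p → Bool
    adj-sym : ∀ i j → adj i j ≡ adj j i
    adj-irr : ∀ i → adj i i ≡ false
open Graph public

Adj : ∀ {p} → Graph p → Fin p → Fin p → Set
Adj G i j = adj G i j ≡ true

bit : Bool → ℕ
bit true  = 1
bit false = 0

degree : ∀ {p} → Graph p → Fin p → ℕ
degree {p} G i = sum (map (λ j → bit (adj G i j)) (allFin p))

edgeCount : ∀ {p} → Graph p → ℕ
edgeCount {p} G =
  sum (concatMap (λ i → map (λ j → bit (⌊ toℕ i <? toℕ j ⌋ ∧ adj G i j)) (allFin p)) (allFin p))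

data Walk {p} (G : Graph p) : Fin p → Fin p → Set where
  here  : ∀ {i} → Walk G i i
  there : ∀ {i j k} → Adj G i j → Walk G j k → Walk G i k

Connected : ∀ {p} → Graph p → Set
Connected G = ∀ i j → Walk G i j

Euler : ∀ {p} → Graph p → Set
Euler G = Connected G × (∀ i → 2 ∣ degree G i)

-- A cycle of length suc n (n ≥ 2, i.e. length ≥ 3): distinct vertices
-- v 0, …, v n with v i ~ v (i+1) and v n ~ v 0.
record Cycle {p} (G : Graph p) (len : ℕ) : Set where
  field
    n       : ℕ
    len≡    : len ≡ suc n
    long    : 2 ≤ n
    vtx     : Fin (suc n) → Fin p
    distinct : Injective _≡_ _≡_ vtx
    step    : ∀ (i : Fin n) → Adj G (vtx (inject₁ i)) (vtx (fsuc i))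
    close   : Adj G (vtx (fromℕ n)) (vtx fzero)

InE0 : ∀ {p} → Graph p → Set
InE0 G = Euler G × (∀ len → Cycle G len → 4 ∣ len)

Bipartite : ∀ {p} → Graph p → Set
Bipartite {p} G = Σ (Fin p → Bool) λ c → ∀ i j → Adj G i j → c i ≢ c j

-- A closed walk of odd length
-- contains an odd cycle (cut it at a repeated vertex into two shorter closed walks, one of them of
-- odd length), so colouring each vertex by the parity of a walk to it from a fixed root is proper.
-- For the edge count: if all degrees are even, a walk that never immediately turns back can be
-- continued forever, so it repeats a vertex and its innermost repetition is a cycle. Deleting the
-- edges of that cycle keeps all degrees even and lowers the degree sum 2q by twice the cycle
-- length, a multiple of 8; by induction 8 divides 2q.

module Submission where

open import Defs
open import Data.Bool using (Bool; true; false; _∧_; _∨_; not; _xor_)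
import Data.Bool as Bool
open import Data.Bool.Properties
  using (not-distribˡ-xor; not-involutive; xor-assoc; xor-comm; xor-same; xor-identityʳ; xor-inverseʳ;
         ∧-zeroʳ; ∧-identityʳ; ∧-comm; ∨-comm)
open import Data.Fin using (Fin; toℕ) renaming (zero to fzero; suc to fsuc)
import Data.Fin.Properties as Finₚ
open Finₚ using (_≟_)
open import Data.List using (List; []; _∷_; map; concat; concatMap; allFin; tabulate)
open import Data.List.Properties using (map-tabulate)
import Data.Nat as ℕ
open import Data.Nat using (ℕ; zero; suc; _+_; _*_; _≤_; _<_; z≤n; s≤s)
open import Data.Nat.Divisibility using (_∣_; _∣0; divides; ∣-trans; ∣m∣n⇒∣m+n; *-monoʳ-∣; *-cancelˡ-∣)
open import Data.Nat.Induction using (<-rec)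
open import Data.Nat.ListAction using (sum)
open import Data.Nat.ListAction.Properties using (sum-++)
open import Data.Nat.Properties hiding (_≟_)
open import Algebra.Properties.CommutativeMonoid.Sum +-0-commutativeMonoid
  using (sum-syntax; ∑-distrib-+; ∑-comm; sum-cong-≗) renaming (sum to ∑)
open import Data.Nat.Solver using (module +-*-Solver)
open import Data.Product using (Σ; ∃₂; _×_; _,_; proj₁; proj₂)
open import Data.Sum using (_⊎_; inj₁; inj₂)
open import Function using (_∘_; case_of_)
open import Relation.Binary.Definitions using (DecidableEquality; tri<; tri≈; tri>)
open import Relation.Binary.PropositionalEquality
open import Relation.Nullary using (contradiction; yes; no; ¬?)
open import Relation.Nullary.Decidable using (⌊_⌋; _×-dec_)

private variable p : ℕ

odd : ℕ → Bool
odd zero    = false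
odd (suc n) = not (odd n)

odd-+ : ∀ m n → odd (m + n) ≡ odd m xor odd n
odd-+ zero    n = refl
odd-+ (suc m) n = trans (cong not (odd-+ m n)) (not-distribˡ-xor (odd m) (odd n))

odd-*2 : ∀ k → odd (k * 2) ≡ false
odd-*2 zero    = refl
odd-*2 (suc k) = trans (not-involutive (odd (k * 2))) (odd-*2 k)

2∣⇒¬odd : ∀ {n} → 2 ∣ n → odd n ≡ false
2∣⇒¬odd (divides k refl) = odd-*2 k

4∣⇒¬odd : ∀ {n} → 4 ∣ n → odd n ≡ false
4∣⇒¬odd = 2∣⇒¬odd ∘ ∣-trans (divides 2 refl)

odd-bit : ∀ b → odd (bit b) ≡ b
odd-bit true  = refl
odd-bit false = refl

bit≢0⇒true : ∀ {b} → bit b ≢ 0 → b ≡ true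
bit≢0⇒true {true}  _    = refl
bit≢0⇒true {false} b≢0 = contradiction refl b≢0

xor≡true : ∀ a b → a xor b ≡ true → a ≡ true ⊎ b ≡ true
xor≡true true  _ _  = inj₁ refl
xor≡true false _ eq = inj₂ eq

xor-cancelʳ : ∀ z a → z xor (a xor a) ≡ z
xor-cancelʳ z a = trans (cong (z xor_) (xor-same a)) (xor-identityʳ z)

xor-telescope : ∀ z a b c → (z xor (b xor c)) xor (a xor b) ≡ z xor (a xor c)
xor-telescope z a b c = begin
  (z xor (b xor c)) xor (a xor b)  ≡⟨ xor-assoc z _ _ ⟩
  z xor ((b xor c) xor (a xor b))  ≡⟨ cong (z xor_) (cong₂ _xor_ (xor-comm b c) (xor-comm a b)) ⟩
  z xor ((c xor b) xor (b xor a))  ≡⟨ cong (z xor_) (xor-assoc c b (b xor a)) ⟩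
  z xor (c xor (b xor (b xor a)))  ≡⟨ cong (λ t → z xor (c xor t)) (sym (xor-assoc b b a)) ⟩
  z xor (c xor ((b xor b) xor a))  ≡⟨ cong (λ t → z xor (c xor (t xor a))) (xor-same b) ⟩
  z xor (c xor a)                  ≡⟨ cong (z xor_) (xor-comm c a) ⟩
  z xor (a xor c)                  ∎
  where open ≡-Reasoning

∑-single : (f : Fin p → ℕ) (a : Fin p) → (∀ j → j ≢ a → f j ≡ 0) → ∑[ j < p ] f j ≡ f a
∑-single {suc p} f fzero    f≡0 =
  trans (cong (f fzero +_) (∑-zero λ j → f≡0 (fsuc j) λ ())) (+-identityʳ (f fzero))
  where
  ∑-zero : ∀ {p} {g : Fin p → ℕ} → (∀ j → g j ≡ 0) → ∑[ j < p ] g j ≡ 0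
  ∑-zero {zero}  g≡0 = refl
  ∑-zero {suc p} g≡0 = cong₂ _+_ (g≡0 fzero) (∑-zero (g≡0 ∘ fsuc))
∑-single {suc p} f (fsuc a) f≡0 =
  cong₂ _+_ (f≡0 fzero λ ()) (∑-single (f ∘ fsuc) a λ j j≢a → f≡0 (fsuc j) (j≢a ∘ Finₚ.suc-injective))

∑≢0⇒∃≢0 : (f : Fin p → ℕ) → ∑[ j < p ] f j ≢ 0 → Σ (Fin p) λ j → f j ≢ 0
∑≢0⇒∃≢0 {zero}  f ∑≢0 = contradiction refl ∑≢0
∑≢0⇒∃≢0 {suc p} f ∑≢0 with f fzero in eq
... | zero  = let j , fj≢0 = ∑≢0⇒∃≢0 (f ∘ fsuc) ∑≢0 in fsuc j , fj≢0
... | suc _ = fzero , λ f0≡0 → 0≢1+n (trans (sym f0≡0) eq)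

sum-map-allFin : (f : Fin p → ℕ) → sum (map f (allFin p)) ≡ ∑[ i < p ] f i
sum-map-allFin {p} f = trans (cong sum (map-tabulate (λ i → i) f)) (sum-tabulate f)
  where
  sum-tabulate : ∀ {p} (g : Fin p → ℕ) → sum (tabulate g) ≡ ∑[ i < p ] g i
  sum-tabulate {zero}  g = refl
  sum-tabulate {suc p} g = cong (g fzero +_) (sum-tabulate (g ∘ fsuc))

sum-concatMap : ∀ {A : Set} (f : A → List ℕ) (xs : List A) →
  sum (concatMap f xs) ≡ sum (map (sum ∘ f) xs)
sum-concatMap f []       = refl
sum-concatMap f (x ∷ xs) = trans (sum-++ (f x) (concat (map f xs))) (cong (sum (f x) +_) (sum-concatMap f xs))

-- Degrees and the handshake lemma

deg : Graph p → Fin p → ℕ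
deg {p} G i = ∑[ j < p ] bit (adj G i j)

totalDegree : Graph p → ℕ
totalDegree {p} G = ∑[ i < p ] deg G i

degree≡deg : (G : Graph p) (i : Fin p) → degree G i ≡ deg G i
degree≡deg G i = sum-map-allFin (λ j → bit (adj G i j))

_≺_ : Fin p → Fin p → Bool
i ≺ j = ⌊ toℕ i <? toℕ j ⌋

upperAdj : Graph p → Fin p → Fin p → ℕ
upperAdj G i j = bit (i ≺ j ∧ adj G i j)

edgeCount≡∑∑ : (G : Graph p) → edgeCount G ≡ ∑[ i < p ] ∑[ j < p ] upperAdj G i j
edgeCount≡∑∑ {p} G = begin
  sum (concatMap row (allFin p))        ≡⟨ sum-concatMap row (allFin p) ⟩
  sum (map (sum ∘ row) (allFin p))      ≡⟨ sum-map-allFin (sum ∘ row) ⟩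
  ∑[ i < p ] sum (row i)                ≡⟨ sum-cong-≗ (λ i → sum-map-allFin (upperAdj G i)) ⟩
  ∑[ i < p ] ∑[ j < p ] upperAdj G i j  ∎
  where
  open ≡-Reasoning
  row : Fin p → List ℕ
  row i = map (upperAdj G i) (allFin p)

bit-adj-split : (G : Graph p) (i j : Fin p) → bit (adj G i j) ≡ upperAdj G i j + upperAdj G j i
bit-adj-split G i j with toℕ i <? toℕ j | toℕ j <? toℕ i
... | yes i<j | yes j<i = contradiction i<j (<-asym j<i)
... | yes _   | no _    = sym (+-identityʳ _)
... | no _    | yes _   = cong bit (adj-sym G i j)
... | no i≮j  | no j≮i  with refl ← Finₚ.toℕ-injective (≤-antisym (≮⇒≥ j≮i) (≮⇒≥ i≮j))
  rewrite adj-irr G i = refl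

handshake : (G : Graph p) → totalDegree G ≡ 2 * edgeCount G
handshake {p} G = begin
  ∑[ i < p ] ∑[ j < p ] bit (adj G i j)
    ≡⟨ sum-cong-≗ (λ i → trans (sum-cong-≗ (bit-adj-split G i))
                               (∑-distrib-+ (upperAdj G i) (λ j → upperAdj G j i))) ⟩
  ∑[ i < p ] (∑[ j < p ] upperAdj G i j + ∑[ j < p ] upperAdj G j i)
    ≡⟨ ∑-distrib-+ (λ i → ∑[ j < p ] upperAdj G i j) (λ i → ∑[ j < p ] upperAdj G j i) ⟩
  E + ∑[ i < p ] ∑[ j < p ] upperAdj G j i
    ≡⟨ cong (E +_) (∑-comm (λ i j → upperAdj G j i)) ⟩
  E + E
    ≡⟨ cong₂ _+_ (sym (edgeCount≡∑∑ G)) (sym (trans (+-identityʳ (edgeCount G)) (edgeCount≡∑∑ G))) ⟩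
  2 * edgeCount G ∎
  where
  open ≡-Reasoning
  E = ∑[ i < p ] ∑[ j < p ] upperAdj G i j

adj⇒≢ : (G : Graph p) {u v : Fin p} → Adj G u v → u ≢ v
adj⇒≢ G {u} uv refl with () ← trans (sym (adj-irr G u)) uv

DistinctUpTo : ∀ {a} {A : Set a} → (ℕ → A) → ℕ → Set a
DistinctUpTo w n = ∀ {a b} → a ≤ n → b ≤ n → w a ≡ w b → a ≡ b

module _ {a} {A : Set a} (_≟_ : DecidableEquality A) where

  repetition-or-distinct : (w : ℕ → A) (n : ℕ) →
    (∃₂ λ x y → x < y × y ≤ n × w x ≡ w y) ⊎ DistinctUpTo w n
  repetition-or-distinct w n with anyUpTo? (λ y → anyUpTo? (λ x → w x ≟ w y) y) (suc n)
  ... | yes (y , s≤s y≤n , x , x<y , wx≡wy) = inj₁ (x , y , x<y , y≤n , wx≡wy)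
  ... | no ¬repetition = inj₂ distinct
    where
    distinct : DistinctUpTo w n
    distinct {x} {y} x≤n y≤n wx≡wy with <-cmp x y
    ... | tri< x<y _ _ = contradiction (y , s≤s y≤n , x , x<y , wx≡wy) ¬repetition
    ... | tri≈ _ x≡y _ = x≡y
    ... | tri> _ _ y<x = contradiction (x , s≤s x≤n , y , y<x , sym wx≡wy) ¬repetition

  Loop : (ℕ → A) → Set a
  Loop w = ∃₂ λ s e → w s ≡ w (s + suc e) × DistinctUpTo (λ k → w (s + k)) e

  innermost-loop : (w : ℕ → A) {x y : ℕ} → x < y → w x ≡ w y → Loop w
  innermost-loop w {x} x<y wx≡wy with d , refl ← m≤n⇒∃[o]m+o≡n x<y =
    <-rec LoopFrom shrink d x (trans wx≡wy (cong w (sym (+-suc x d))))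
    where
    LoopFrom : ℕ → Set a
    LoopFrom d = ∀ x → w x ≡ w (x + suc d) → Loop w
    shrink : ∀ d → (∀ {o} → o < d → LoopFrom o) → LoopFrom d
    shrink d smaller x closed with repetition-or-distinct (λ k → w (x + k)) d
    ... | inj₂ distinct = x , d , closed , distinct
    ... | inj₁ (i , j , i<j , j≤d , wi≡wj) with o , refl ← m≤n⇒∃[o]m+o≡n i<j =
      smaller (<-≤-trans (s≤s (m≤n+m o i)) j≤d) (x + i)
        (trans wi≡wj (cong w (trans (cong (x +_) (sym (+-suc i o))) (sym (+-assoc x i (suc o))))))

IsWalk : Graph p → (ℕ → Fin p) → ℕ → Set
IsWalk G w m = ∀ k → k < m → Adj G (w k) (w (suc k))

IsWalk-≤ : {G : Graph p} {w : ℕ → Fin p} {l m : ℕ} → l ≤ m → IsWalk G w m → IsWalk G w l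
IsWalk-≤ l≤m walk k k<l = walk k (<-≤-trans k<l l≤m)

IsWalk-shift : {G : Graph p} {w : ℕ → Fin p} (x : ℕ) {l : ℕ} →
  IsWalk G w (x + l) → IsWalk G (λ k → w (x + k)) l
IsWalk-shift {G = G} {w} x walk k k<l =
  subst (λ y → Adj G (w (x + k)) (w y)) (sym (+-suc x k)) (walk (x + k) (+-monoʳ-< x k<l))

record CycleSeq (G : Graph p) : Set where
  field
    n        : ℕ
    vtx      : ℕ → Fin p
    long     : 2 ≤ n
    distinct : DistinctUpTo vtx n
    walk     : IsWalk G vtx (suc n)
    closed   : vtx (suc n) ≡ vtx 0

toCycle : {G : Graph p} (C : CycleSeq G) → Cycle G (suc (CycleSeq.n C))
toCycle {G = G} C = record
  { n        = n
  ; len≡     = refl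
  ; long     = long
  ; vtx      = vtx ∘ toℕ
  ; distinct = λ {i} {j} eq → Finₚ.toℕ-injective (distinct (Finₚ.toℕ≤pred[n] i) (Finₚ.toℕ≤pred[n] j) eq)
  ; step     = λ i → subst (λ k → Adj G (vtx k) (vtx (suc (toℕ i)))) (sym (Finₚ.toℕ-inject₁ i))
                           (walk (toℕ i) (m<n⇒m<1+n (Finₚ.toℕ<n i)))
  ; close    = subst (λ k → Adj G (vtx k) (vtx 0)) (sym (Finₚ.toℕ-fromℕ n))
                     (subst (Adj G (vtx n)) closed (walk n ≤-refl))
  }
  where open CycleSeq C

Cycle-mono : {G H : Graph p} → (∀ i j → Adj H i j → Adj G i j) → ∀ {len} → Cycle H len → Cycle G len
Cycle-mono H⊆G C = record
  { n = n ; len≡ = len≡ ; long = long ; vtx = vtx ; distinct = distinct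
  ; step = λ i → H⊆G _ _ (step i) ; close = H⊆G _ _ close }
  where open Cycle C

-- Graphs without odd cycles are bipartite

-- For w x ≡ w (x + l): the walk w with its closed sub-walk from time x to time x + l cut out.
skipLoop : ∀ {a} {A : Set a} → (ℕ → A) → ℕ → ℕ → ℕ → A
skipLoop w x l k with k ≤? x
... | yes _ = w k
... | no _  = w (k + l)

module _ {a} {A : Set a} {w : ℕ → A} {x l : ℕ} where

  skipLoop-≤ : ∀ {k} → k ≤ x → skipLoop w x l k ≡ w k
  skipLoop-≤ {k} k≤x with k ≤? x
  ... | yes _   = refl
  ... | no k≰x = contradiction k≤x k≰x

  skipLoop-> : ∀ {k} → x < k → skipLoop w x l k ≡ w (k + l)
  skipLoop-> {k} x<k with k ≤? x
  ... | yes k≤x = contradiction k≤x (<⇒≱ x<k)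
  ... | no _    = refl

IsWalk-skipLoop : {G : Graph p} {w : ℕ → Fin p} {x l L : ℕ} → w x ≡ w (x + l) →
  IsWalk G w (L + l) → IsWalk G (skipLoop w x l) L
IsWalk-skipLoop {G = G} {w} {x} {l} {L} loop walk k k<L with <-cmp k x
... | tri< k<x _ _ rewrite skipLoop-≤ {w = w} {l = l} (<⇒≤ k<x) | skipLoop-≤ {w = w} {l = l} k<x =
  walk k (≤-trans k<L (m≤m+n L l))
... | tri≈ _ refl _ rewrite skipLoop-≤ {w = w} {l = l} (≤-refl {k}) | skipLoop-> {w = w} {l = l} (n<1+n k) =
  subst (λ v → Adj G v (w (suc (k + l)))) (sym loop) (walk (k + l) (+-monoˡ-< l k<L))
... | tri> _ _ x<k rewrite skipLoop-> {w = w} {l = l} x<k | skipLoop-> {w = w} {l = l} (m<n⇒m<1+n x<k) =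
  walk (k + l) (+-monoˡ-< l k<L)

loop+rest : ∀ x o r → suc (suc x + o + r) ≡ (x + suc r) + suc o
loop+rest = solve 3 (λ x o r → con 2 :+ x :+ o :+ r := (x :+ (con 1 :+ r)) :+ (con 1 :+ o)) refl
  where open +-*-Solver

module LoopAndRest (G : Graph p) {w : ℕ → Fin p} {x o r : ℕ}
  (walk : IsWalk G w (suc (suc x + o + r))) (closed : w (suc (suc x + o + r)) ≡ w 0)
  (repeat : w x ≡ w (suc x + o)) where

  loop-walk : IsWalk G (λ k → w (x + k)) (suc o)
  loop-walk = IsWalk-shift {G = G} {w} x (IsWalk-≤ {G = G} {w} inside walk)
    where
    inside : x + suc o ≤ suc (suc x + o + r)
    inside = ≤-trans (≤-reflexive (+-suc x o)) (≤-trans (m≤m+n (suc x + o) r) (n≤1+n _))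

  loop-closed : w (x + suc o) ≡ w (x + 0)
  loop-closed = trans (cong w (+-suc x o)) (trans (sym repeat) (cong w (sym (+-identityʳ x))))

  loop-shorter : suc o < suc (suc x + o + r)
  loop-shorter = subst (suc o <_) (sym (loop+rest x o r)) (m<n+m (suc o) (subst (0 <_) (sym (+-suc x r)) (s≤s z≤n)))

  rest-walk : IsWalk G (skipLoop w x (suc o)) (x + suc r)
  rest-walk = IsWalk-skipLoop {G = G} {w} (trans repeat (cong w (sym (+-suc x o))))
                                          (subst (IsWalk G w) (loop+rest x o r) walk)

  rest-closed : skipLoop w x (suc o) (x + suc r) ≡ skipLoop w x (suc o) 0
  rest-closed = begin
    skipLoop w x (suc o) (x + suc r)  ≡⟨ skipLoop-> {w = w} (m<m+n x (s≤s z≤n)) ⟩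
    w (x + suc r + suc o)             ≡⟨ cong w (sym (loop+rest x o r)) ⟩
    w (suc (suc x + o + r))           ≡⟨ closed ⟩
    w 0                               ≡⟨ sym (skipLoop-≤ {w = w} {x = x} {l = suc o} z≤n) ⟩
    skipLoop w x (suc o) 0            ∎
    where open ≡-Reasoning

  rest-shorter : x + suc r < suc (suc x + o + r)
  rest-shorter = subst (x + suc r <_) (sym (loop+rest x o r)) (m<m+n (x + suc r) (s≤s z≤n))

OddCycle : Graph p → Set
OddCycle G = Σ (CycleSeq G) λ C → odd (suc (CycleSeq.n C)) ≡ true

odd-closed-walk⇒odd-cycle : (G : Graph p) (m : ℕ) (w : ℕ → Fin p) →
  IsWalk G w m → w m ≡ w 0 → odd m ≡ true → OddCycle G
odd-closed-walk⇒odd-cycle {p} G = <-rec OddClosed split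
  where
  OddClosed : ℕ → Set
  OddClosed m = (w : ℕ → Fin p) → IsWalk G w m → w m ≡ w 0 → odd m ≡ true → OddCycle G

  split : ∀ m → (∀ {m′} → m′ < m → OddClosed m′) → OddClosed m
  split (suc n) shorter w walk closed oddm with repetition-or-distinct Finₚ._≟_ w n
  ... | inj₂ distinct = record
    { n = n ; vtx = w ; long = long n walk closed oddm ; distinct = distinct ; walk = walk ; closed = closed } , oddm
    where
    long : ∀ k → IsWalk G w (suc k) → w (suc k) ≡ w 0 → odd (suc k) ≡ true → 2 ≤ k
    long zero          walk closed _ = contradiction (sym closed) (adj⇒≢ G (walk 0 (s≤s z≤n)))
    long (suc (suc _)) _    _      _ = s≤s (s≤s z≤n)
  ... | inj₁ (x , y , x<y , y≤n , repeat)
    with o , refl ← m≤n⇒∃[o]m+o≡n x<y | r , refl ← m≤n⇒∃[o]m+o≡n y≤n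
    -- the lengths x + suc r of the rest and suc o of the loop add up to m, so one of them is odd
    with xor≡true (odd (x + suc r)) (odd (suc o))
                  (trans (sym (odd-+ (x + suc r) (suc o))) (subst (λ k → odd k ≡ true) (loop+rest x o r) oddm))
  ... | inj₁ oddRest = shorter rest-shorter _ rest-walk rest-closed oddRest
    where open LoopAndRest G walk closed repeat
  ... | inj₂ oddLoop = shorter loop-shorter _ loop-walk loop-closed oddLoop
    where open LoopAndRest G walk closed repeat

module _ {G : Graph p} where

  walkLength : ∀ {a b} → Walk G a b → ℕ
  walkLength here        = 0
  walkLength (there _ W) = suc (walkLength W)

  _++ʷ_ : ∀ {a b c} → Walk G a b → Walk G b c → Walk G a c
  here      ++ʷ V = V
  there e W ++ʷ V = there e (W ++ʷ V)

  walkLength-++ : ∀ {a b c} (W : Walk G a b) (V : Walk G b c) →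
    walkLength (W ++ʷ V) ≡ walkLength W + walkLength V
  walkLength-++ here        V = refl
  walkLength-++ (there _ W) V = cong suc (walkLength-++ W V)

  reverse : ∀ {a b} → Walk G a b → Walk G b a
  reverse here                    = here
  reverse (there {i} {j} ij W) = reverse W ++ʷ there (trans (adj-sym G j i) ij) here

  walkLength-reverse : ∀ {a b} (W : Walk G a b) → walkLength (reverse W) ≡ walkLength W
  walkLength-reverse here        = refl
  walkLength-reverse (there _ W) =
    trans (walkLength-++ (reverse W) _) (trans (+-comm (walkLength (reverse W)) 1) (cong suc (walkLength-reverse W)))

  vertexAt : ∀ {a b} → Walk G a b → ℕ → Fin p
  vertexAt {a} here        _       = a
  vertexAt {a} (there _ W) zero    = a
  vertexAt     (there _ W) (suc k) = vertexAt W k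

  vertexAt-0 : ∀ {a b} (W : Walk G a b) → vertexAt W 0 ≡ a
  vertexAt-0 here        = refl
  vertexAt-0 (there _ W) = refl

  vertexAt-end : ∀ {a b} (W : Walk G a b) → vertexAt W (walkLength W) ≡ b
  vertexAt-end here        = refl
  vertexAt-end (there _ W) = vertexAt-end W

  IsWalk-vertexAt : ∀ {a b} (W : Walk G a b) → IsWalk G (vertexAt W) (walkLength W)
  IsWalk-vertexAt (there ij W) zero    _         = subst (Adj G _) (sym (vertexAt-0 W)) ij
  IsWalk-vertexAt (there _  W) (suc k) (s≤s k<) = IsWalk-vertexAt W k k<

no-odd-cycle⇒bipartite : (G : Graph p) → Connected G → (∀ len → Cycle G len → odd len ≡ false) → Bipartite G
no-odd-cycle⇒bipartite {zero}  G _         _         = (λ ()) , λ ()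
no-odd-cycle⇒bipartite {suc p} G connected noOddCycle = colour , proper
  where
  colour : Fin (suc p) → Bool
  colour i = odd (walkLength (connected fzero i))

  viaEdge : ∀ i j → Adj G i j → Walk G fzero fzero
  viaEdge i j ij = connected fzero i ++ʷ there ij (reverse (connected fzero j))

  odd-viaEdge : ∀ i j (ij : Adj G i j) → colour i ≡ colour j → odd (walkLength (viaEdge i j ij)) ≡ true
  odd-viaEdge i j ij same = begin
    odd (walkLength (viaEdge i j ij))                   ≡⟨ cong odd (walkLength-++ Wᵢ _) ⟩
    odd (walkLength Wᵢ + suc (walkLength (reverse Wⱼ)))
      ≡⟨ cong (λ n → odd (walkLength Wᵢ + suc n)) (walkLength-reverse Wⱼ) ⟩
    odd (walkLength Wᵢ + suc (walkLength Wⱼ))           ≡⟨ odd-+ (walkLength Wᵢ) _ ⟩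
    colour i xor not (colour j)                         ≡⟨ cong (_xor not (colour j)) same ⟩
    colour j xor not (colour j)                         ≡⟨ xor-inverseʳ (colour j) ⟩
    true                                                ∎
    where
    open ≡-Reasoning
    Wᵢ = connected fzero i
    Wⱼ = connected fzero j

  proper : ∀ i j → Adj G i j → colour i ≢ colour j
  proper i j ij same =
    let C , oddC = odd-closed-walk⇒odd-cycle G _ _ (IsWalk-vertexAt W) closed (odd-viaEdge i j ij same)
    in case trans (sym oddC) (noOddCycle _ (toCycle C)) of λ ()
    where
    W = viaEdge i j ij
    closed : vertexAt W (walkLength W) ≡ vertexAt W 0
    closed = trans (vertexAt-end W) (sym (vertexAt-0 W))

-- Deleting edges

_==_ : Fin p → Fin p → Bool
i == j = ⌊ i ≟ j ⌋

==-refl : (i : Fin p) → i == i ≡ true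
==-refl i with i ≟ i
... | yes _   = refl
... | no i≢i = contradiction refl i≢i

==⇒≡ : {i j : Fin p} → i == j ≡ true → i ≡ j
==⇒≡ {i = i} {j} eq with i ≟ j
... | yes i≡j = i≡j

≢⇒==false : {i j : Fin p} → i ≢ j → i == j ≡ false
≢⇒==false {i = i} {j} i≢j with i ≟ j
... | yes i≡j = contradiction i≡j i≢j
... | no _    = refl

sameEdge : Fin p → Fin p → Fin p → Fin p → Bool
sameEdge u v i j = (i == u ∧ j == v) ∨ (i == v ∧ j == u)

sameEdge-sym : (u v i j : Fin p) → sameEdge u v i j ≡ sameEdge u v j i
sameEdge-sym u v i j
  rewrite ∧-comm (i == u) (j == v) | ∧-comm (i == v) (j == u) = ∨-comm (j == v ∧ i == u) (j == u ∧ i == v)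

sameEdge-false : {u v i j : Fin p} → i ≢ u → (i ≡ v → j ≢ u) → sameEdge u v i j ≡ false
sameEdge-false {u = u} {v} {i} {j} i≢u j≢u rewrite ≢⇒==false i≢u with i ≟ v
... | yes i≡v rewrite ≢⇒==false (j≢u i≡v) = refl
... | no _    = refl

deleteEdge : Graph p → Fin p → Fin p → Graph p
deleteEdge G u v = record
  { adj     = λ i j → adj G i j ∧ not (sameEdge u v i j)
  ; adj-sym = λ i j → cong₂ (λ a b → a ∧ not b) (adj-sym G i j) (sameEdge-sym u v i j)
  ; adj-irr = λ i → cong (_∧ not (sameEdge u v i i)) (adj-irr G i)
  }

deleteEdge-⊆ : (G : Graph p) (u v i j : Fin p) → Adj (deleteEdge G u v) i j → Adj G i j
deleteEdge-⊆ G u v i j ij with adj G i j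
... | true = refl

deleteEdge-keeps : (G : Graph p) (u v i j : Fin p) →
  Adj G i j → sameEdge u v i j ≡ false → Adj (deleteEdge G u v) i j
deleteEdge-keeps G u v i j ij ¬same rewrite ij | ¬same = refl

bit-remove-disjoint : ∀ a x z → (x ≡ true → a ≡ true) → (z ≡ true → a ≡ true) →
  (x ≡ true → z ≢ true) →
  bit a ≡ bit (a ∧ not (x ∨ z)) + (bit x + bit z)
bit-remove-disjoint true  false false _ _ _ = refl
bit-remove-disjoint true  true  false _ _ _ = refl
bit-remove-disjoint true  false true  _ _ _ = refl
bit-remove-disjoint true  true  true  _ _ x⇒¬z = contradiction refl (x⇒¬z refl)
bit-remove-disjoint false false false _ _ _ = refl
bit-remove-disjoint false true  _ x⇒a _ _ with () ← x⇒a refl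
bit-remove-disjoint false false true _ z⇒a _ with () ← z⇒a refl

∑-bit-∧-== : (c : Bool) (v : Fin p) → ∑[ j < p ] bit (c ∧ j == v) ≡ bit c
∑-bit-∧-== c v = trans
  (∑-single (λ j → bit (c ∧ j == v)) v
    λ j j≢v → cong bit (trans (cong (c ∧_) (≢⇒==false j≢v)) (∧-zeroʳ c)))
  (cong bit (trans (cong (c ∧_) (==-refl v)) (∧-identityʳ c)))

deg-deleteEdge : (G : Graph p) {u v : Fin p} → Adj G u v → (i : Fin p) →
  deg G i ≡ deg (deleteEdge G u v) i + (bit (i == u) + bit (i == v))
deg-deleteEdge {p} G {u} {v} uv i = begin
  ∑[ j < p ] bit (adj G i j)
    ≡⟨ sum-cong-≗ (λ j → bit-remove-disjoint (adj G i j) _ _ (forward j) (backward j) (not-both j)) ⟩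
  ∑[ j < p ] (bit (adj G' i j) + (bit (i == u ∧ j == v) + bit (i == v ∧ j == u)))
    ≡⟨ ∑-distrib-+ (λ j → bit (adj G' i j)) _ ⟩
  deg G' i + ∑[ j < p ] (bit (i == u ∧ j == v) + bit (i == v ∧ j == u))
    ≡⟨ cong (deg G' i +_) (∑-distrib-+ (λ j → bit (i == u ∧ j == v)) _) ⟩
  deg G' i + (∑[ j < p ] bit (i == u ∧ j == v) + ∑[ j < p ] bit (i == v ∧ j == u))
    ≡⟨ cong (deg G' i +_) (cong₂ _+_ (∑-bit-∧-== (i == u) v) (∑-bit-∧-== (i == v) u)) ⟩
  deg G' i + (bit (i == u) + bit (i == v)) ∎
  where
  open ≡-Reasoning
  G' = deleteEdge G u v
  both : ∀ a b x y → a == x ∧ b == y ≡ true → a ≡ x × b ≡ y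
  both a b x y eq with a == x in ax | b == y in by
  ... | true | true = ==⇒≡ ax , ==⇒≡ by
  forward : ∀ j → i == u ∧ j == v ≡ true → adj G i j ≡ true
  forward j eq with refl , refl ← both i j u v eq = uv
  backward : ∀ j → i == v ∧ j == u ≡ true → adj G i j ≡ true
  backward j eq with refl , refl ← both i j v u eq = trans (adj-sym G v u) uv
  not-both : ∀ j → i == u ∧ j == v ≡ true → i == v ∧ j == u ≢ true
  not-both j eq eq′ = adj⇒≢ G uv (trans (sym (proj₁ (both i j u v eq))) (proj₁ (both i j v u eq′)))

totalDegree-deleteEdge : (G : Graph p) {u v : Fin p} → Adj G u v →
  totalDegree G ≡ totalDegree (deleteEdge G u v) + 2
totalDegree-deleteEdge {p} G {u} {v} uv = begin
  ∑[ i < p ] deg G i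
    ≡⟨ sum-cong-≗ (deg-deleteEdge G uv) ⟩
  ∑[ i < p ] (deg G' i + (bit (i == u) + bit (i == v)))
    ≡⟨ ∑-distrib-+ (deg G') _ ⟩
  totalDegree G' + ∑[ i < p ] (bit (i == u) + bit (i == v))
    ≡⟨ cong (totalDegree G' +_)
         (trans (∑-distrib-+ (λ i → bit (i == u)) _) (cong₂ _+_ (∑-bit-== u) (∑-bit-== v))) ⟩
  totalDegree G' + 2 ∎
  where
  open ≡-Reasoning
  G' = deleteEdge G u v
  ∑-bit-== : (w : Fin p) → ∑[ i < p ] bit (i == w) ≡ 1
  ∑-bit-== w =
    trans (∑-single (λ i → bit (i == w)) w λ i i≢w → cong bit (≢⇒==false i≢w)) (cong bit (==-refl w))

odd-deg-deleteEdge : (G : Graph p) {u v : Fin p} → Adj G u v → (i : Fin p) →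
  odd (deg G i) ≡ odd (deg (deleteEdge G u v) i) xor ((i == u) xor (i == v))
odd-deg-deleteEdge G {u} {v} uv i = begin
  odd (deg G i)                                              ≡⟨ cong odd (deg-deleteEdge G uv i) ⟩
  odd (deg G' i + (bit (i == u) + bit (i == v)))             ≡⟨ odd-+ (deg G' i) _ ⟩
  odd (deg G' i) xor odd (bit (i == u) + bit (i == v))       ≡⟨ cong (odd (deg G' i) xor_) (odd-+ (bit (i == u)) _) ⟩
  odd (deg G' i) xor (odd (bit (i == u)) xor odd (bit (i == v)))
    ≡⟨ cong (odd (deg G' i) xor_) (cong₂ _xor_ (odd-bit (i == u)) (odd-bit (i == v))) ⟩
  odd (deg G' i) xor ((i == u) xor (i == v))                  ∎
  where
  open ≡-Reasoning
  G' = deleteEdge G u v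

module CycleRemoval {G : Graph p} (C : CycleSeq G) where
  open CycleSeq C

  pruned : ℕ → Graph p
  pruned zero    = G
  pruned (suc r) = deleteEdge (pruned r) (vtx r) (vtx (suc r))

  pruned-⊆ : ∀ r i j → Adj (pruned r) i j → Adj G i j
  pruned-⊆ zero    i j ij = ij
  pruned-⊆ (suc r) i j ij = pruned-⊆ r i j (deleteEdge-⊆ (pruned r) (vtx r) (vtx (suc r)) i j ij)

  edges-distinct : ∀ {r′ r} → r′ < r → r ≤ n →
    sameEdge (vtx r′) (vtx (suc r′)) (vtx r) (vtx (suc r)) ≡ false
  edges-distinct {r′} {r} r′<r r≤n = sameEdge-false (λ eq → <⇒≢ r′<r (sym (distinct r≤n r′≤n eq))) later
    where
    r′≤n : r′ ≤ n
    r′≤n = ≤-trans (<⇒≤ r′<r) r≤n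
    later : vtx r ≡ vtx (suc r′) → vtx (suc r) ≢ vtx r′
    later eq with refl ← distinct r≤n (≤-trans r′<r r≤n) eq | m≤n⇒m<n∨m≡n r≤n
    ... | inj₁ r<n  = λ eq′ → <⇒≢ (m<n⇒m<1+n r′<r) (sym (distinct r<n r′≤n eq′))
    ... | inj₂ refl = λ eq′ → <⇒≢ (≤-pred long) (distinct z≤n r′≤n (trans (sym closed) eq′))

  pruned-keeps : ∀ {r′ r} → r′ ≤ r → r ≤ n → Adj (pruned r′) (vtx r) (vtx (suc r))
  pruned-keeps {zero}   _    r≤n = walk _ (s≤s r≤n)
  pruned-keeps {suc r′} r′<r r≤n =
    deleteEdge-keeps (pruned r′) _ _ _ _ (pruned-keeps (<⇒≤ r′<r) r≤n) (edges-distinct r′<r r≤n)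

  totalDegree-pruned : ∀ r → r ≤ suc n → totalDegree G ≡ totalDegree (pruned r) + 2 * r
  totalDegree-pruned zero    _         = sym (+-identityʳ (totalDegree G))
  totalDegree-pruned (suc r) (s≤s r≤n) = begin
    totalDegree G                         ≡⟨ totalDegree-pruned r (m≤n⇒m≤1+n r≤n) ⟩
    totalDegree (pruned r) + 2 * r        ≡⟨ cong (_+ 2 * r) (totalDegree-deleteEdge (pruned r) (pruned-keeps ≤-refl r≤n)) ⟩
    totalDegree pruned′ + 2 + 2 * r       ≡⟨ +-assoc (totalDegree pruned′) 2 (2 * r) ⟩
    totalDegree pruned′ + (2 + 2 * r)     ≡⟨ cong (totalDegree pruned′ +_) (sym (*-suc 2 r)) ⟩
    totalDegree pruned′ + 2 * suc r       ∎
    where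
    open ≡-Reasoning
    pruned′ = pruned (suc r)

  odd-deg-pruned : ∀ r → r ≤ suc n → ∀ i →
    odd (deg G i) ≡ odd (deg (pruned r) i) xor ((i == vtx 0) xor (i == vtx r))
  odd-deg-pruned zero    _         i = sym (xor-cancelʳ (odd (deg G i)) (i == vtx 0))
  odd-deg-pruned (suc r) (s≤s r≤n) i = begin
    odd (deg G i)
      ≡⟨ odd-deg-pruned r (m≤n⇒m≤1+n r≤n) i ⟩
    odd (deg (pruned r) i) xor ((i == vtx 0) xor (i == vtx r))
      ≡⟨ cong (_xor _) (odd-deg-deleteEdge (pruned r) (pruned-keeps ≤-refl r≤n) i) ⟩
    (odd (deg (pruned (suc r)) i) xor ((i == vtx r) xor (i == vtx (suc r)))) xor ((i == vtx 0) xor (i == vtx r))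
      ≡⟨ xor-telescope (odd (deg (pruned (suc r)) i)) (i == vtx 0) (i == vtx r) (i == vtx (suc r)) ⟩
    odd (deg (pruned (suc r)) i) xor ((i == vtx 0) xor (i == vtx (suc r))) ∎
    where open ≡-Reasoning

  remainder : Graph p
  remainder = pruned (suc n)

  totalDegree-remainder : totalDegree G ≡ totalDegree remainder + 2 * suc n
  totalDegree-remainder = totalDegree-pruned (suc n) ≤-refl

  odd-deg-remainder : ∀ i → odd (deg G i) ≡ odd (deg remainder i)
  odd-deg-remainder i = begin
    odd (deg G i)                                                   ≡⟨ odd-deg-pruned (suc n) ≤-refl i ⟩
    odd (deg remainder i) xor ((i == vtx 0) xor (i == vtx (suc n)))
      ≡⟨ cong (λ v → odd (deg remainder i) xor ((i == vtx 0) xor (i == v))) closed ⟩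
    odd (deg remainder i) xor ((i == vtx 0) xor (i == vtx 0))       ≡⟨ xor-cancelʳ _ (i == vtx 0) ⟩
    odd (deg remainder i)                                           ∎
    where open ≡-Reasoning

-- Cycles in graphs with even degrees

EvenDegrees : Graph p → Set
EvenDegrees G = ∀ i → odd (deg G i) ≡ false

another-neighbour : (G : Graph p) → EvenDegrees G → ∀ {u v} → Adj G u v →
  Σ (Fin p) λ x → Adj G v x × x ≢ u
another-neighbour G even {u} {v} uv with Finₚ.any? (λ x → (adj G v x Bool.≟ true) ×-dec ¬? (x ≟ u))
... | yes found = found
... | no none = contradiction (trans (sym (cong odd deg≡1)) (even v)) λ ()
  where
  only-u : ∀ x → x ≢ u → bit (adj G v x) ≡ 0
  only-u x x≢u with adj G v x in vx
  ... | true  = contradiction (x , vx , x≢u) none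
  ... | false = refl
  deg≡1 : deg G v ≡ 1
  deg≡1 = trans (∑-single (λ x → bit (adj G v x)) u only-u) (cong bit (trans (adj-sym G v u) uv))

record Arc (G : Graph p) : Set where
  constructor arc
  field
    tail head : Fin p
    edge      : Adj G tail head

module NonBacktrackingWalk {G : Graph p} (even : EvenDegrees G) {u v : Fin p} (uv : Adj G u v) where

  turn : Arc G → Arc G
  turn (arc t h th) = arc h (proj₁ (another-neighbour G even th)) (proj₁ (proj₂ (another-neighbour G even th)))

  turn-not-back : ∀ a → Arc.head (turn a) ≢ Arc.tail a
  turn-not-back (arc t h th) = proj₂ (proj₂ (another-neighbour G even th))

  arcs : ℕ → Arc G
  arcs zero    = arc u v uv
  arcs (suc k) = turn (arcs k)

  w : ℕ → Fin p
  w k = Arc.tail (arcs k)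

  adjacent : ∀ k → Adj G (w k) (w (suc k))
  adjacent k = Arc.edge (arcs k)

  non-backtracking : ∀ k → w (suc (suc k)) ≢ w k
  non-backtracking k = turn-not-back (arcs k)

  loop-long : ∀ {s} e → w s ≡ w (s + suc e) → 2 ≤ e
  loop-long {s} zero       ws≡ = contradiction (trans ws≡ (cong w (+-comm s 1))) (adj⇒≢ G (adjacent s))
  loop-long {s} (suc zero) ws≡ = contradiction (sym (trans ws≡ (cong w (+-comm s 2)))) (non-backtracking s)
  loop-long (suc (suc _))  _   = s≤s (s≤s z≤n)

  cycle : CycleSeq G
  cycle with _ , _ , i<j , wi≡wj ← Finₚ.pigeonhole (n<1+n p) (w ∘ toℕ)
    with s , e , loop , distinct ← innermost-loop _≟_ w i<j wi≡wj = record
    { n        = e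
    ; vtx      = λ k → w (s + k)
    ; long     = loop-long {s} e loop
    ; distinct = distinct
    ; walk     = IsWalk-shift {G = G} {w} s (λ k _ → adjacent k)
    ; closed   = trans (sym loop) (cong w (sym (+-identityʳ s)))
    }

even-degrees⇒cycle : (G : Graph p) → EvenDegrees G → ∀ {u v} → Adj G u v → CycleSeq G
even-degrees⇒cycle G even uv = NonBacktrackingWalk.cycle even uv

CyclesDivisibleBy4 : Graph p → Set
CyclesDivisibleBy4 G = ∀ len → Cycle G len → 4 ∣ len

some-edge : (G : Graph p) → totalDegree G ≢ 0 → Σ (Fin p) λ u → Σ (Fin p) λ v → Adj G u v
some-edge G T≢0 =
  let u , deg≢0 = ∑≢0⇒∃≢0 (deg G) T≢0
      v , bit≢0 = ∑≢0⇒∃≢0 (λ v → bit (adj G u v)) deg≢0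
  in u , v , bit≢0⇒true bit≢0

8∣totalDegree : (G : Graph p) → EvenDegrees G → CyclesDivisibleBy4 G → 8 ∣ totalDegree G
8∣totalDegree {p} G = <-rec Claim prune (totalDegree G) G refl
  where
  Claim : ℕ → Set
  Claim t = (G : Graph p) → totalDegree G ≡ t → EvenDegrees G → CyclesDivisibleBy4 G → 8 ∣ totalDegree G

  prune : ∀ t → (∀ {t′} → t′ < t → Claim t′) → Claim t
  prune _ smaller G refl even cycles4 with totalDegree G ℕ.≟ 0
  ... | yes T≡0 = subst (8 ∣_) (sym T≡0) (8 ∣0)
  ... | no T≢0 with _ , _ , uv ← some-edge G T≢0 =
    subst (8 ∣_) (sym totalDegree-remainder)
      (∣m∣n⇒∣m+n (smaller shrinks remainder refl evenRemainder cyclesRemainder)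
                  (*-monoʳ-∣ 2 (cycles4 _ (toCycle C))))
    where
    C = even-degrees⇒cycle G even uv
    open CycleRemoval C
    shrinks : totalDegree remainder < totalDegree G
    shrinks = subst (totalDegree remainder <_) (sym totalDegree-remainder) (m<m+n (totalDegree remainder) (s≤s z≤n))
    evenRemainder : EvenDegrees remainder
    evenRemainder i = trans (sym (odd-deg-remainder i)) (even i)
    cyclesRemainder : CyclesDivisibleBy4 remainder
    cyclesRemainder len = cycles4 len ∘ Cycle-mono (pruned-⊆ (suc (CycleSeq.n C)))

4∣edgeCount : (G : Graph p) → (∀ i → 2 ∣ degree G i) → CyclesDivisibleBy4 G → 4 ∣ edgeCount G
4∣edgeCount G evenDegree cycles4 = *-cancelˡ-∣ 2 (subst (8 ∣_) (handshake G) (8∣totalDegree G even cycles4))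
  where
  even : EvenDegrees G
  even i = 2∣⇒¬odd (subst (2 ∣_) (degree≡deg G i) (evenDegree i))

theorem2 : (p q : ℕ) (G : Graph p) → InE0 G → edgeCount G ≡ q → Bipartite G × (4 ∣ q)
theorem2 p q G ((connected , evenDegree) , cycles4) refl =
  no-odd-cycle⇒bipartite G connected (λ len → 4∣⇒¬odd ∘ cycles4 len) , 4∣edgeCount G evenDegree cycles4
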